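{- Let $P$ be a finite poset for which $J(P)$ is tCDE with edge density $\delta$. Then for every $\ell\geq1$, the statistic $\mathrm{ddeg}$ on $\mathrm{PP}^{\ell}(P)$ is $\ell\cdot\delta$-mesic with respect to the action of $\mathrm{row}$ on $\mathrm{PP}^{\ell}(P)$, i.e., its average over every $\mathrm{row}$-orbit of $\mathrm{PP}^{\ell}(P)$ equals $\ell\delta$.
   Context: $J(P)$ is the set of order ideals of $P$; $\mathrm{ddeg}(I)$ is the number of maximal elements of $I$. Toggles: $\tau_p(I)=I\cup\{p\}$ if $p\notin I$ and $I\cup\{p\}\in J(P)$; $I\setminus\{p\}$ if $p\in I$ and $I\setminus\{p\}\in J(P)$; $I$ otherwise. $\mathcal{T}_p(I)$ is $1$ if $I\subsetneq\tau_p(I)$, $-1$ if $\tau_p(I)\subsetneq I$, and $0$ otherwise. A distribution $\mu$ on $J(P)$ is toggle-symmetric if $\mathbb{E}_\mu[\mathcal{T}_p]=0$ for all $p$; the edge density is the uniform average of $\mathrm{ddeg}$ over $J(P)$; $J(P)$ is tCDE if $\mathbb{E}_\mu[\mathrm{ddeg}]$ equals the edge density for every toggle-symmetric $\mu$. $\mathrm{PP}^{\ell}(P)$ is the set of weakly order-preserving maps $T\colon P\to\{0,\ldots,\ell\}$, and $\mathrm{ddeg}(T)=\sum_{i=0}^{\ell-1}\mathrm{ddeg}(T^{ -1}(\{0,\ldots,i\}))$. Let $\widehat P$ be $P$ with new minimum $\widehat0$ and maximum $\widehat1$; regard $f\in\mathbb{R}^P$ as a function on $\widehat P$ with $f(\widehat0)=0$,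 $f(\widehat1)=1$. The toggle $\tau^{\mathrm{PL}}_p$ leaves $f(q)$ unchanged for $q\neq p$ and replaces $f(p)$ by $\min\{f(x): x\in\widehat P\text{ covers }p\}+\max\{f(x): p\text{ covers }x\in\widehat P\}-f(p)$; $\mathrm{row}^{\mathrm{PL}}=\tau^{\mathrm{PL}}_{p_1}\circ\cdots\circ\tau^{\mathrm{PL}}_{p_N}$ for a linear extension $p_1,\ldots,p_N$ of $P$; and $\mathrm{row}\colon\mathrm{PP}^{\ell}(P)\to\mathrm{PP}^{\ell}(P)$ is $\mathrm{row}(T)=\ell\cdot\mathrm{row}^{\mathrm{PL}}(\tfrac1\ell T)$. -}

module Defs where

open import Data.Nat as ℕ using (ℕ; zero; suc)
open import Data.Integer as ℤ using (+_; -[1+_])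
open import Data.Fin as Fin using (Fin)
open import Data.Fin.Properties using () renaming (_≟_ to _≟F_)
open import Data.Bool using (Bool; true; false; _∧_; not; if_then_else_)
open import Data.List using (List; []; _∷_; map; foldr; length; filterᵇ; allFin; upTo)
open import Data.Bool.ListAction using (all)
open import Data.Nat.ListAction using (sum)
open import Relation.Nullary using (¬_)
open import Data.List.Membership.Propositional using (_∈_)
open import Data.List.Relation.Unary.Unique.Propositional using (Unique)
import Data.List as List
open import Data.Vec as Vec using (Vec; lookup; _[_]≔_; tabulate)
open import Data.Rational as ℚ using (ℚ; 0ℚ; 1ℚ; _+_; _*_; _-_; _⊓_; _⊔_; _≤ᵇ_)
open import Data.Product using (_×_)
open import Relation.Nullary using (does)
open import Relation.Binary.PropositionalEquality using (_≡_)
open import Relation.Binary.Structures using (IsDecPartialOrder)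

-- A finite poset: carrier Fin n with a decidable partial order.
-- (Every finite poset is isomorphic to one of this form.)

record FinPoset : Set₁ where
  field
    n                 : ℕ
    _≼_               : Fin n → Fin n → Set
    isDecPartialOrder : IsDecPartialOrder _≡_ _≼_
  open IsDecPartialOrder isDecPartialOrder public
    using () renaming (_≤?_ to _≼?_)

sumℚ : List ℚ → ℚ
sumℚ = foldr _+_ 0ℚ

fromℕ : ℕ → ℚ
fromℕ m = + m ℚ./ 1

-- q / m  (with the junk value 0 for m = 0; only used with m ≥ 1)
divℕ : ℚ → ℕ → ℚ
divℕ q zero    = 0ℚ
divℕ q (suc m) = q * (+ 1 ℚ./ suc m)

minOr : ℚ → List ℚ → ℚ
minOr d []       = d
minOr d (x ∷ xs) = foldr _⊓_ x xs

maxOr : ℚ → List ℚ → ℚ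
maxOr d []       = d
maxOr d (x ∷ xs) = foldr _⊔_ x xs

iter : {A : Set} → (A → A) → ℕ → A → A
iter f zero    x = x
iter f (suc k) x = f (iter f k x)

allSubsets : (m : ℕ) → List (Vec Bool m)
allSubsets zero    = Vec.[] ∷ []
allSubsets (suc m) =
  List._++_ (map (true Vec.∷_) (allSubsets m)) (map (false Vec.∷_) (allSubsets m))

module _ (P : FinPoset) where
  open FinPoset P

  elems : List (Fin n)
  elems = allFin n

  leb : Fin n → Fin n → Bool
  leb p q = does (p ≼? q)

  ltb : Fin n → Fin n → Bool
  ltb p q = leb p q ∧ not (does (p ≟F q))

  coversᵇ : Fin n → Fin n → Bool
  coversᵇ q p = ltb p q ∧ all (λ r → not (ltb p r ∧ ltb r q)) elems

  Subset : Set
  Subset = Vec Bool n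

  isIdealᵇ : Subset → Bool
  isIdealᵇ S =
    all (λ p → all (λ q → not (leb q p ∧ lookup S p ∧ not (lookup S q))) elems) elems

  ideals : List Subset
  ideals = filterᵇ isIdealᵇ (allSubsets n)

  isMaxIn : Subset → Fin n → Bool
  isMaxIn S p = lookup S p ∧ all (λ q → not (ltb p q ∧ lookup S q)) elems

  ddeg : Subset → ℕ
  ddeg S = length (filterᵇ (isMaxIn S) elems)

  τ : Fin n → Subset → Subset
  τ p I =
    if not (lookup I p) ∧ isIdealᵇ (I [ p ]≔ true) then I [ p ]≔ true
    else (if lookup I p ∧ isIdealᵇ (I [ p ]≔ false) then I [ p ]≔ false else I)

  -- toggleability statistic 𝒯_p : 1 if I ⊊ τ_p I, -1 if τ_p I ⊊ I, 0 otherwise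
  -- (τ_p I ≠ I exactly when p is added, resp. removed, as tested below)
  𝒯 : Fin n → Subset → ℚ
  𝒯 p I =
    if not (lookup I p) ∧ isIdealᵇ (I [ p ]≔ true) then 1ℚ
    else (if lookup I p ∧ isIdealᵇ (I [ p ]≔ false) then ℚ.-_ 1ℚ else 0ℚ)

  IsDistribution : (Subset → ℚ) → Set
  IsDistribution μ =
    (∀ I → I ∈ ideals → 0ℚ ℚ.≤ μ I) × (sumℚ (map μ ideals) ≡ 1ℚ)

  expect : (Subset → ℚ) → (Subset → ℚ) → ℚ
  expect μ f = sumℚ (map (λ I → μ I * f I) ideals)

  ToggleSymmetric : (Subset → ℚ) → Set
  ToggleSymmetric μ = ∀ p → expect μ (𝒯 p) ≡ 0ℚ

  ddegℚ : Subset → ℚ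
  ddegℚ I = fromℕ (ddeg I)

  edgeDensity : ℚ
  edgeDensity = divℕ (sumℚ (map ddegℚ ideals)) (length ideals)

  tCDE : Set
  tCDE = ∀ μ → IsDistribution μ → ToggleSymmetric μ → expect μ ddegℚ ≡ edgeDensity

  IsPP : ℕ → (Fin n → ℕ) → Set
  IsPP ℓ T = (∀ p → T p ℕ.≤ ℓ) × (∀ p q → p ≼ q → T p ℕ.≤ T q)

  preimageLE : (Fin n → ℚ) → ℕ → Subset
  preimageLE f i = tabulate (λ p → f p ≤ᵇ fromℕ i)

  ddegPP : ℕ → (Fin n → ℚ) → ℕ
  ddegPP ℓ f = sum (map (λ i → ddeg (preimageLE f i)) (upTo ℓ))

  -- min{ f x : x covers p in P̂ }  (the only cover can be 1̂, with f(1̂)=1)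
  upperPL : (Fin n → ℚ) → Fin n → ℚ
  upperPL f p = minOr 1ℚ (map f (filterᵇ (λ q → coversᵇ q p) elems))

  -- max{ f x : p covers x in P̂ }  (the only one can be 0̂, with f(0̂)=0)
  lowerPL : (Fin n → ℚ) → Fin n → ℚ
  lowerPL f p = maxOr 0ℚ (map f (filterᵇ (λ q → coversᵇ p q) elems))

  τPL : Fin n → (Fin n → ℚ) → (Fin n → ℚ)
  τPL p f q = if does (q ≟F p) then upperPL f p + lowerPL f p - f p else f q

  record LinearExtension : Set where
    field
      list     : List (Fin n)
      complete : ∀ p → p ∈ list
      unique   : Unique list
      respects : ∀ i j → List.lookup list i ≼ List.lookup list j → i Fin.≤ j

  rowPL : LinearExtension → (Fin n → ℚ) → (Fin n → ℚ)
  rowPL L f = foldr τPL f (LinearExtension.list L)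

  row : LinearExtension → ℕ → (Fin n → ℚ) → (Fin n → ℚ)
  row L ℓ f q = fromℕ ℓ * rowPL L (λ r → divℕ (f r) ℓ) q

  embed : (Fin n → ℕ) → (Fin n → ℚ)
  embed T p = fromℕ (T p)

  orbitAverage : LinearExtension → ℕ → (Fin n → ℕ) → ℕ → ℚ
  orbitAverage L ℓ T k =
    divℕ (sumℚ (map (λ i → fromℕ (ddegPP ℓ (iter (row L ℓ) i (embed T)))) (upTo k))) k

  IsOrbitSize : LinearExtension → ℕ → (Fin n → ℕ) → ℕ → Set
  IsOrbitSize L ℓ T k =
    (1 ℕ.≤ k) × (∀ p → iter (row L ℓ) k (embed T) p ≡ embed T p)
    × (∀ j → 1 ℕ.≤ j → j ℕ.< k → ¬ (∀ p → iter (row L ℓ) j (embed T) p ≡ embed T p))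

  Mesic : LinearExtension → ℕ → ℚ → Set
  Mesic L ℓ c = ∀ T → IsPP ℓ T → ∀ k → IsOrbitSize L ℓ T k → orbitAverage L ℓ T k ≡ c

-- Rowmotion on PP^ℓ(P) is integral: scaled by ℓ, the piecewise-linear toggle at p becomes the
-- integer toggle T(p) ↦ upper + lower − T(p), where upper (lower) is the least (greatest) value of T
-- on the upper (lower) covers of p, with ℓ standing for 1̂ and 0 for 0̂. Toggling along the linear
-- extension from the top yields the recurrence  row T(p) + T(p) = upper(row T)(p) + lower(T)(p).
-- Encode T by its ℓ sublevel ideals T⁻¹{0,…,i}, i < ℓ: p is addable in exactly T(p) − lower of
-- them and removable in exactly upper − T(p). Summed over a row-orbit, the recurrence makes these
-- two totals agree, so the uniform distribution on the kℓ sublevel ideals met along the orbit is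
-- toggle-symmetric. By tCDE its ddeg-average is the edge density δ; since ddeg(T) is the sum of
-- ddeg over the sublevel ideals of T, the orbit average of ddeg is ℓδ.

module Submission where

open import Defs
open import Data.Bool using (Bool; true; false; T; not; _∧_; if_then_else_)
open import Data.Bool.ListAction using (all)
open import Data.Bool.Properties using (T?; T-∧; T-≡; T-not-≡; if-float; if-cong-then)
import Data.Bool.Properties as Boolₚ
open import Data.Empty using (⊥-elim)
open import Data.Fin as Fin using (Fin; toℕ)
import Data.Fin.Properties as Finₚ
import Data.Integer as ℤ
import Data.Integer.Properties as ℤₚ
open import Data.List as List
  using (List; []; _∷_; [_]; map; foldr; concat; allFin; upTo; applyUpTo; length; filterᵇ; _++_)
import Data.List.Properties as Listₚ
open import Data.List.Membership.Propositional using (_∈_; _∉_)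
open import Data.List.Membership.Propositional.Properties
  using (∈-allFin; ∈-filter⁺; ∈-filter⁻; ∈-map⁺; ∈-upTo⁻)
open import Data.List.Relation.Unary.All as All using (All; _∷_)
open import Data.List.Relation.Unary.All.Properties using (all⁺; all⁻; map⁺; concat⁺)
open import Data.List.Relation.Unary.AllPairs using (AllPairs; []; _∷_)
open import Data.List.Relation.Unary.Any as Any using (Any; here; there; index)
import Data.List.Relation.Unary.Any.Properties as Anyₚ
open import Data.Nat as ℕ using (ℕ; zero; suc; _≤_; _<_; _∸_; _+_; _⊓_; _⊔_; z≤n; s≤s)
import Data.Nat.Coprimality as Coprime
open import Data.Nat.ListAction using (sum)
open import Data.Nat.ListAction.Properties using (sum-++)
import Data.Nat.Properties as ℕₚ
open import Algebra.Properties.CommutativeSemigroup ℕₚ.+-commutativeSemigroup using (interchange)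
open import Data.Product using (_×_; _,_; proj₁; proj₂; ∃-syntax)
open import Data.Rational as ℚ using (ℚ; mkℚ; 0ℚ; 1ℚ; _*_)
import Data.Rational.Properties as ℚₚ
open import Data.Rational.Solver using (module +-*-Solver)
import Data.Rational.Unnormalised as ℚᵘ
import Data.Rational.Unnormalised.Properties as ℚᵘₚ
open import Data.Sum using (_⊎_; inj₁; inj₂)
open import Data.Unit using (tt)
open import Data.Vec as Vec using (Vec; lookup; tabulate; _[_]≔_)
import Data.Vec.Properties as Vecₚ
open import Function using (_⇔_; mk⇔; Equivalence; const; _∘_)
open import Relation.Binary.PropositionalEquality hiding ([_])
open import Relation.Binary.Structures using (IsDecPartialOrder)
open import Relation.Nullary using (Dec; yes; no; does; ¬_)
open import Relation.Nullary.Decidable using (decidable-stable)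

open Equivalence using (to; from)

T-injective : ∀ {a b} → T a ⇔ T b → a ≡ b
T-injective {false} {false} _   = refl
T-injective {false} {true}  a⇔b = ⊥-elim (from a⇔b tt)
T-injective {true}  {false} a⇔b = ⊥-elim (to a⇔b tt)
T-injective {true}  {true}  _   = refl

T-not⇔ : ∀ {b} → T (not b) ⇔ (¬ T b)
T-not⇔ {false} = mk⇔ (λ _ ()) (const tt)
T-not⇔ {true}  = mk⇔ (λ ()) (λ ¬t → ¬t tt)

T-does⇔ : ∀ {A : Set} (d : Dec A) → T (does d) ⇔ A
T-does⇔ (yes a) = mk⇔ (const a) (const tt)
T-does⇔ (no ¬a) = mk⇔ (λ ()) ¬a

true-if : ∀ {b} → T b → b ≡ true
true-if = to T-≡

false-if : ∀ {b} → ¬ T b → b ≡ false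
false-if = to T-not-≡ ∘ from T-not⇔

T-all-allFin⇔ : ∀ {n} (p : Fin n → Bool) → T (all p (allFin n)) ⇔ (∀ x → T (p x))
T-all-allFin⇔ p = mk⇔ (λ t x → All.lookup (all⁺ p _ t) (∈-allFin x))
                      (λ h → all⁻ p {xs = allFin _} (All.tabulate (λ {x} _ → h x)))

indicator : Bool → ℕ
indicator b = if b then 1 else 0

minOrℕ : ℕ → List ℕ → ℕ
minOrℕ d []       = d
minOrℕ d (x ∷ xs) = foldr _⊓_ x xs

maxOrℕ : ℕ → List ℕ → ℕ
maxOrℕ d []       = d
maxOrℕ d (x ∷ xs) = foldr _⊔_ x xs

∈⇒minOrℕ-≤ : ∀ {d y} xs → y ∈ xs → minOrℕ d xs ≤ y
∈⇒minOrℕ-≤ (x ∷ xs) y∈ = Listₚ.foldr-preservesᵒ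
  (λ a b → λ { (inj₁ a≤y) → ℕₚ.m≤n⇒m⊓o≤n b a≤y
              ; (inj₂ b≤y) → ℕₚ.m≤n⇒o⊓m≤n a b≤y })
  x xs (head-or-tail y∈)
  where
  head-or-tail : ∀ {y} → y ∈ x ∷ xs → x ≤ y ⊎ Any (_≤ y) xs
  head-or-tail (here y≡x)   = inj₁ (ℕₚ.≤-reflexive (sym y≡x))
  head-or-tail (there y∈xs) = inj₂ (Any.map (ℕₚ.≤-reflexive ∘ sym) y∈xs)

≤-minOrℕ : ∀ {d b} xs → b ≤ d → All (b ≤_) xs → b ≤ minOrℕ d xs
≤-minOrℕ []       b≤d _             = b≤d
≤-minOrℕ (x ∷ xs) _   (b≤x ∷ b≤xs) = Listₚ.foldr-preservesᵇ ℕₚ.⊓-glb b≤x b≤xs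

minOrℕ-≤ : ∀ {d} b xs → d ≤ b → All (_≤ b) xs → minOrℕ d xs ≤ b
minOrℕ-≤ b []       d≤b _           = d≤b
minOrℕ-≤ b (x ∷ xs) _   (x≤b ∷ _) =
  ℕₚ.≤-trans (∈⇒minOrℕ-≤ {d = b} (x ∷ xs) (here refl)) x≤b

∈⇒≤-maxOrℕ : ∀ {d y} xs → y ∈ xs → y ≤ maxOrℕ d xs
∈⇒≤-maxOrℕ (x ∷ xs) y∈ = Listₚ.foldr-preservesᵒ
  (λ a b → λ { (inj₁ y≤a) → ℕₚ.m≤n⇒m≤n⊔o b y≤a
              ; (inj₂ y≤b) → ℕₚ.m≤n⇒m≤o⊔n a y≤b })
  x xs (head-or-tail y∈)
  where
  head-or-tail : ∀ {y} → y ∈ x ∷ xs → y ≤ x ⊎ Any (y ≤_) xs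
  head-or-tail (here y≡x)   = inj₁ (ℕₚ.≤-reflexive y≡x)
  head-or-tail (there y∈xs) = inj₂ (Any.map ℕₚ.≤-reflexive y∈xs)

maxOrℕ-≤ : ∀ {d b} xs → d ≤ b → All (_≤ b) xs → maxOrℕ d xs ≤ b
maxOrℕ-≤ []       d≤b _             = d≤b
maxOrℕ-≤ (x ∷ xs) _   (x≤b ∷ xs≤b) = Listₚ.foldr-preservesᵇ ℕₚ.⊔-lub x≤b xs≤b

x≤u⇒l≤u+l∸x : ∀ {l x u} → x ≤ u → l ≤ u + l ∸ x
x≤u⇒l≤u+l∸x {l} {x} {u} x≤u = ℕₚ.≤-trans (ℕₚ.≤-reflexive (sym (ℕₚ.m+n∸m≡n x l)))
                                          (ℕₚ.∸-monoˡ-≤ x (ℕₚ.+-monoˡ-≤ l x≤u))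

l≤x⇒u+l∸x≤u : ∀ {l x u} → l ≤ x → u + l ∸ x ≤ u
l≤x⇒u+l∸x≤u {l} {x} {u} l≤x = ℕₚ.≤-trans (ℕₚ.∸-monoˡ-≤ x (ℕₚ.+-monoʳ-≤ u l≤x))
                                          (ℕₚ.≤-reflexive (ℕₚ.m+n∸n≡m u x))

sum-map-+ : ∀ {A : Set} (f g : A → ℕ) xs →
            sum (map (λ x → f x + g x) xs) ≡ sum (map f xs) + sum (map g xs)
sum-map-+ f g []       = refl
sum-map-+ f g (x ∷ xs) =
  trans (cong (f x + g x +_) (sum-map-+ f g xs)) (interchange (f x) (g x) _ _)

sum-upTo-suc : ∀ (f : ℕ → ℕ) k → sum (map f (upTo (suc k))) ≡ sum (map f (upTo k)) + f k
sum-upTo-suc f k = begin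
  sum (map f (upTo (suc k)))           ≡⟨ cong (sum ∘ map f) (Listₚ.upTo-∷ʳ k) ⟨
  sum (map f (upTo k ++ [ k ]))        ≡⟨ cong sum (Listₚ.map-++ f (upTo k) [ k ]) ⟩
  sum (map f (upTo k) ++ [ f k ])      ≡⟨ sum-++ (map f (upTo k)) [ f k ] ⟩
  sum (map f (upTo k)) + (f k + 0) ≡⟨ cong (sum (map f (upTo k)) +_) (ℕₚ.+-identityʳ (f k)) ⟩
  sum (map f (upTo k)) + f k         ∎
  where open ≡-Reasoning

sum-concat : ∀ xss → sum (concat xss) ≡ sum (map sum xss)
sum-concat []         = refl
sum-concat (xs ∷ xss) = trans (sum-++ xs (concat xss)) (cong (sum xs +_) (sum-concat xss))

sum-map-concat : ∀ {A : Set} (f : A → ℕ) xss →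
                 sum (map f (concat xss)) ≡ sum (map (sum ∘ map f) xss)
sum-map-concat f xss = begin
  sum (map f (concat xss))            ≡⟨ cong sum (Listₚ.concat-map xss) ⟨
  sum (concat (map (map f) xss))      ≡⟨ sum-concat (map (map f) xss) ⟩
  sum (map sum (map (map f) xss))     ≡⟨ cong sum (Listₚ.map-∘ xss) ⟨
  sum (map (sum ∘ map f) xss)         ∎
  where open ≡-Reasoning

sumℚ-map-+ : ∀ {A : Set} (f g : A → ℚ) xs →
             sumℚ (map (λ x → f x ℚ.+ g x) xs) ≡ sumℚ (map f xs) ℚ.+ sumℚ (map g xs)
sumℚ-map-+ f g []       = refl
sumℚ-map-+ f g (x ∷ xs) =
  trans (cong (f x ℚ.+ g x ℚ.+_) (sumℚ-map-+ f g xs)) (lemma (f x) (g x) _ _)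
  where
  open +-*-Solver
  lemma : ∀ a b c d → (a ℚ.+ b) ℚ.+ (c ℚ.+ d) ≡ (a ℚ.+ c) ℚ.+ (b ℚ.+ d)
  lemma = solve 4 (λ a b c d → (a :+ b) :+ (c :+ d) := (a :+ c) :+ (b :+ d)) refl

sumℚ-map-- : ∀ {A : Set} (f g : A → ℚ) xs →
             sumℚ (map (λ x → f x ℚ.- g x) xs) ≡ sumℚ (map f xs) ℚ.- sumℚ (map g xs)
sumℚ-map-- f g []       = refl
sumℚ-map-- f g (x ∷ xs) =
  trans (cong (f x ℚ.- g x ℚ.+_) (sumℚ-map-- f g xs)) (lemma (f x) (g x) _ _)
  where
  open +-*-Solver
  lemma : ∀ a b c d → (a ℚ.- b) ℚ.+ (c ℚ.- d) ≡ (a ℚ.+ c) ℚ.- (b ℚ.+ d)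
  lemma = solve 4 (λ a b c d → (a :- b) :+ (c :- d) := (a :+ c) :- (b :+ d)) refl

sumℚ-map-*ˡ : ∀ {A : Set} c (f : A → ℚ) xs →
              sumℚ (map (λ x → c * f x) xs) ≡ c * sumℚ (map f xs)
sumℚ-map-*ˡ c f []       = sym (ℚₚ.*-zeroʳ c)
sumℚ-map-*ˡ c f (x ∷ xs) =
  trans (cong (c * f x ℚ.+_) (sumℚ-map-*ˡ c f xs)) (sym (ℚₚ.*-distribˡ-+ c (f x) _))

count-< : ∀ t M → sum (map (λ i → indicator (i ℕ.<ᵇ t)) (upTo M)) ≡ M ⊓ t
count-< t zero    = refl
count-< t (suc M) = begin
  sum (map f (upTo (suc M)))  ≡⟨ sum-upTo-suc f M ⟩
  sum (map f (upTo M)) + f M  ≡⟨ cong (_+ f M) (count-< t M) ⟩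
  M ⊓ t + f M               ≡⟨ step ⟩
  suc M ⊓ t                   ∎
  where
  open ≡-Reasoning
  f : ℕ → ℕ
  f i = indicator (i ℕ.<ᵇ t)
  step : M ⊓ t + f M ≡ suc M ⊓ t
  step with M ℕ.<? t
  ... | yes M<t rewrite true-if (ℕₚ.<⇒<ᵇ M<t) = begin
    M ⊓ t + 1  ≡⟨ cong (_+ 1) (ℕₚ.m≤n⇒m⊓n≡m (ℕₚ.<⇒≤ M<t)) ⟩
    M + 1      ≡⟨ ℕₚ.+-comm M 1 ⟩
    suc M        ≡⟨ ℕₚ.m≤n⇒m⊓n≡m M<t ⟨
    suc M ⊓ t    ∎
  ... | no M≮t rewrite false-if (M≮t ∘ ℕₚ.<ᵇ⇒< M t) = begin
    M ⊓ t + 0  ≡⟨ ℕₚ.+-identityʳ (M ⊓ t) ⟩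
    M ⊓ t        ≡⟨ ℕₚ.m≥n⇒m⊓n≡n t≤M ⟩
    t            ≡⟨ ℕₚ.m≥n⇒m⊓n≡n (ℕₚ.m≤n⇒m≤1+n t≤M) ⟨
    suc M ⊓ t    ∎
    where
    t≤M : t ≤ M
    t≤M = ℕₚ.≮⇒≥ M≮t

indicator-interval : ∀ {l t} i → l ≤ t →
  indicator ((l ℕ.≤ᵇ i) ∧ (i ℕ.<ᵇ t)) + indicator (i ℕ.<ᵇ l) ≡ indicator (i ℕ.<ᵇ t)
indicator-interval {l} {t} i l≤t with i ℕ.<? l
... | yes i<l rewrite false-if (ℕₚ.<⇒≱ i<l ∘ ℕₚ.≤ᵇ⇒≤ l i)
                    | true-if (ℕₚ.<⇒<ᵇ i<l)
                    | true-if (ℕₚ.<⇒<ᵇ (ℕₚ.<-≤-trans i<l l≤t)) = refl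
... | no i≮l  rewrite true-if (ℕₚ.≤⇒≤ᵇ (ℕₚ.≮⇒≥ i≮l))
                    | false-if (i≮l ∘ ℕₚ.<ᵇ⇒< i l) = ℕₚ.+-identityʳ _

count-interval : ∀ {l t} M → l ≤ t → t ≤ M →
  sum (map (λ i → indicator ((l ℕ.≤ᵇ i) ∧ (i ℕ.<ᵇ t))) (upTo M)) + l ≡ t
count-interval {l} {t} M l≤t t≤M = begin
  sum (map inside (upTo M)) + l
    ≡⟨ cong (sum (map inside (upTo M)) +_)
            (trans (count-< l M) (ℕₚ.m≥n⇒m⊓n≡n (ℕₚ.≤-trans l≤t t≤M))) ⟨
  sum (map inside (upTo M)) + sum (map (below l) (upTo M))
    ≡⟨ sum-map-+ inside (below l) (upTo M) ⟨
  sum (map (λ i → inside i + below l i) (upTo M))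
    ≡⟨ cong sum (Listₚ.map-cong (λ i → indicator-interval i l≤t) (upTo M)) ⟩
  sum (map (below t) (upTo M))
    ≡⟨ trans (count-< t M) (ℕₚ.m≥n⇒m⊓n≡n t≤M) ⟩
  t ∎
  where
  open ≡-Reasoning
  inside : ℕ → ℕ
  inside i = indicator ((l ℕ.≤ᵇ i) ∧ (i ℕ.<ᵇ t))
  below : ℕ → ℕ → ℕ
  below s i = indicator (i ℕ.<ᵇ s)

sum-shift : ∀ (g : ℕ → ℕ) k → g k ≡ g 0 → sum (map (g ∘ suc) (upTo k)) ≡ sum (map g (upTo k))
sum-shift g k gk≡g0 = ℕₚ.+-cancelʳ-≡ _ _ _ (begin
  sum (map (g ∘ suc) (upTo k)) + g 0  ≡⟨ ℕₚ.+-comm _ (g 0) ⟩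
  g 0 + sum (map (g ∘ suc) (upTo k))  ≡⟨ cong (λ xs → g 0 + sum xs) (Listₚ.map-upTo (g ∘ suc) k) ⟩
  sum (applyUpTo g (suc k))             ≡⟨ cong sum (Listₚ.map-upTo g (suc k)) ⟨
  sum (map g (upTo (suc k)))            ≡⟨ sum-upTo-suc g k ⟩
  sum (map g (upTo k)) + g k          ≡⟨ cong (sum (map g (upTo k)) +_) gk≡g0 ⟩
  sum (map g (upTo k)) + g 0          ∎)
  where open ≡-Reasoning

sum-map-const : ∀ {A : Set} c (xs : List A) → sum (map (λ _ → c) xs) ≡ length xs ℕ.* c
sum-map-const c []       = refl
sum-map-const c (x ∷ xs) = cong (c +_) (sum-map-const c xs)

sum-map-zero : ∀ {A : Set} (xs : List A) → sum (map (λ _ → 0) xs) ≡ 0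
sum-map-zero xs = trans (sum-map-const 0 xs) (ℕₚ.*-zeroʳ (length xs))

sumℚ-map-0 : ∀ {A : Set} (xs : List A) → sumℚ (map (λ _ → 0ℚ) xs) ≡ 0ℚ
sumℚ-map-0 []       = refl
sumℚ-map-0 (x ∷ xs) = trans (ℚₚ.+-identityˡ _) (sumℚ-map-0 xs)

fromℕ-nf : ℕ → ℚ
fromℕ-nf m = mkℚ (ℤ.+ m) 0 (Coprime.sym (Coprime.1-coprimeTo m))

fromℕ≡nf : ∀ m → fromℕ m ≡ fromℕ-nf m
fromℕ≡nf m = ℚₚ.normalize-coprime (Coprime.sym (Coprime.1-coprimeTo m))

fromℕ-+ : ∀ a b → fromℕ (a + b) ≡ fromℕ a ℚ.+ fromℕ b
fromℕ-+ a b rewrite fromℕ≡nf a | fromℕ≡nf b | fromℕ≡nf (a + b) =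
  ℚₚ.toℚᵘ-injective (ℚᵘₚ.≃-trans (ℚᵘ.*≡* cross)
                                  (ℚᵘₚ.≃-sym (ℚₚ.toℚᵘ-homo-+ (fromℕ-nf a) (fromℕ-nf b))))
  where
  cross : ℤ.+ (a + b) ℤ.* ℤ.+ 1 ≡ (ℤ.+ a ℤ.* ℤ.+ 1 ℤ.+ ℤ.+ b ℤ.* ℤ.+ 1) ℤ.* ℤ.+ 1
  cross = trans (ℤₚ.*-identityʳ _)
    (sym (trans (ℤₚ.*-identityʳ _)
                (cong₂ ℤ._+_ (ℤₚ.*-identityʳ (ℤ.+ a)) (ℤₚ.*-identityʳ (ℤ.+ b)))))

fromℕ-* : ∀ a b → fromℕ (a ℕ.* b) ≡ fromℕ a * fromℕ b
fromℕ-* a b rewrite fromℕ≡nf a | fromℕ≡nf b | fromℕ≡nf (a ℕ.* b) =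
  ℚₚ.toℚᵘ-injective (ℚᵘₚ.≃-trans (ℚᵘ.*≡* cross)
                                  (ℚᵘₚ.≃-sym (ℚₚ.toℚᵘ-homo-* (fromℕ-nf a) (fromℕ-nf b))))
  where
  cross : ℤ.+ (a ℕ.* b) ℤ.* ℤ.+ 1 ≡ (ℤ.+ a ℤ.* ℤ.+ b) ℤ.* ℤ.+ 1
  cross = trans (ℤₚ.*-identityʳ _) (sym (trans (ℤₚ.*-identityʳ _) (sym (ℤₚ.pos-* a b))))

fromℕ-mono-≤ : ∀ {a b} → a ≤ b → fromℕ a ℚ.≤ fromℕ b
fromℕ-mono-≤ {a} {b} a≤b rewrite fromℕ≡nf a | fromℕ≡nf b =
  ℚ.*≤* (subst₂ ℤ._≤_ (sym (ℤₚ.*-identityʳ (ℤ.+ a))) (sym (ℤₚ.*-identityʳ (ℤ.+ b)))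
                      (ℤ.+≤+ a≤b))

fromℕ-cancel-≤ : ∀ {a b} → fromℕ a ℚ.≤ fromℕ b → a ≤ b
fromℕ-cancel-≤ {a} {b} fa≤fb rewrite fromℕ≡nf a | fromℕ≡nf b with fa≤fb
... | ℚ.*≤* a≤b =
  ℤₚ.drop‿+≤+ (subst₂ ℤ._≤_ (ℤₚ.*-identityʳ (ℤ.+ a)) (ℤₚ.*-identityʳ (ℤ.+ b)) a≤b)

fromℕ-injective : ∀ {a b} → fromℕ a ≡ fromℕ b → a ≡ b
fromℕ-injective fa≡fb = ℕₚ.≤-antisym (fromℕ-cancel-≤ (ℚₚ.≤-reflexive fa≡fb))
                                     (fromℕ-cancel-≤ (ℚₚ.≤-reflexive (sym fa≡fb)))

fromℕ-≤ᵇ : ∀ a b → (fromℕ a ℚ.≤ᵇ fromℕ b) ≡ (a ℕ.≤ᵇ b)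
fromℕ-≤ᵇ a b = T-injective (mk⇔
  (λ t → ℕₚ.≤⇒≤ᵇ (fromℕ-cancel-≤ {a} {b} (ℚₚ.≤ᵇ⇒≤ t)))
  (λ t → ℚₚ.≤⇒≤ᵇ (fromℕ-mono-≤ (ℕₚ.≤ᵇ⇒≤ a b t))))

fromℕ-sum : ∀ {A : Set} (f : A → ℕ) xs → fromℕ (sum (map f xs)) ≡ sumℚ (map (fromℕ ∘ f) xs)
fromℕ-sum f []       = refl
fromℕ-sum f (x ∷ xs) = trans (fromℕ-+ (f x) _) (cong (fromℕ (f x) ℚ.+_) (fromℕ-sum f xs))

fromℕ-*-inverse : ∀ m → fromℕ (suc m) * (ℤ.+ 1 ℚ./ suc m) ≡ 1ℚ
fromℕ-*-inverse m = trans
  (cong₂ _*_ (fromℕ≡nf (suc m)) (ℚₚ.normalize-coprime (Coprime.1-coprimeTo (suc m))))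
  (ℚₚ.*-inverseʳ (fromℕ-nf (suc m)))

module _ (f : ℕ → ℚ) (f-mono : ∀ {a b} → a ≤ b → f a ℚ.≤ f b) where

  mono⇒distrib-⊓ : ∀ a b → f (a ⊓ b) ≡ f a ℚ.⊓ f b
  mono⇒distrib-⊓ a b with ℕₚ.≤-total a b
  ... | inj₁ a≤b = trans (cong f (ℕₚ.m≤n⇒m⊓n≡m a≤b)) (sym (ℚₚ.p≤q⇒p⊓q≡p (f-mono a≤b)))
  ... | inj₂ b≤a = trans (cong f (ℕₚ.m≥n⇒m⊓n≡n b≤a)) (sym (ℚₚ.p≥q⇒p⊓q≡q (f-mono b≤a)))

  mono⇒distrib-⊔ : ∀ a b → f (a ⊔ b) ≡ f a ℚ.⊔ f b
  mono⇒distrib-⊔ a b with ℕₚ.≤-total a b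
  ... | inj₁ a≤b = trans (cong f (ℕₚ.m≤n⇒m⊔n≡n a≤b)) (sym (ℚₚ.p≤q⇒p⊔q≡q (f-mono a≤b)))
  ... | inj₂ b≤a = trans (cong f (ℕₚ.m≥n⇒m⊔n≡m b≤a)) (sym (ℚₚ.p≥q⇒p⊔q≡p (f-mono b≤a)))

  foldr-⊓-map-mono : ∀ x xs → foldr ℚ._⊓_ (f x) (map f xs) ≡ f (foldr _⊓_ x xs)
  foldr-⊓-map-mono x []       = refl
  foldr-⊓-map-mono x (y ∷ ys) =
    trans (cong (f y ℚ.⊓_) (foldr-⊓-map-mono x ys)) (sym (mono⇒distrib-⊓ y _))

  foldr-⊔-map-mono : ∀ x xs → foldr ℚ._⊔_ (f x) (map f xs) ≡ f (foldr _⊔_ x xs)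
  foldr-⊔-map-mono x []       = refl
  foldr-⊔-map-mono x (y ∷ ys) =
    trans (cong (f y ℚ.⊔_) (foldr-⊔-map-mono x ys)) (sym (mono⇒distrib-⊔ y _))

  minOr-map-mono : ∀ d xs → minOr (f d) (map f xs) ≡ f (minOrℕ d xs)
  minOr-map-mono d []       = refl
  minOr-map-mono d (x ∷ xs) = foldr-⊓-map-mono x xs

  maxOr-map-mono : ∀ d xs → maxOr (f d) (map f xs) ≡ f (maxOrℕ d xs)
  maxOr-map-mono d []       = refl
  maxOr-map-mono d (x ∷ xs) = foldr-⊔-map-mono x xs

-- Covers and order ideals

module Order (P : FinPoset) where
  open FinPoset P
  open IsDecPartialOrder isDecPartialOrder public
    using () renaming (refl to ≼-refl; trans to ≼-trans)

  infix 4 _≺_ _⋖_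

  _≺_ : Fin n → Fin n → Set
  p ≺ q = p ≼ q × p ≢ q

  _⋖_ : Fin n → Fin n → Set
  p ⋖ q = p ≺ q × (∀ r → p ≺ r → ¬ r ≺ q)

  T-leb⇔ : ∀ {p q} → T (leb P p q) ⇔ p ≼ q
  T-leb⇔ {p} {q} = T-does⇔ (p ≼? q)

  T-ltb⇔ : ∀ {p q} → T (ltb P p q) ⇔ p ≺ q
  T-ltb⇔ {p} {q} = mk⇔
    (λ t → let p≤q , p≠q = to T-∧ t in
      to T-leb⇔ p≤q , to T-not⇔ p≠q ∘ from (T-does⇔ (p Fin.≟ q)))
    (λ (p≼q , p≢q) → from T-∧ (from T-leb⇔ p≼q , from T-not⇔ (p≢q ∘ to (T-does⇔ (p Fin.≟ q)))))

  T-coversᵇ⇔ : ∀ {p q} → T (coversᵇ P q p) ⇔ p ⋖ q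
  T-coversᵇ⇔ {p} {q} = mk⇔
    (λ t → let p<q , none = to T-∧ t in
      to T-ltb⇔ p<q ,
      λ r p≺r r≺q → to T-not⇔ (to (T-all-allFin⇔ _) none r)
                               (from T-∧ (from T-ltb⇔ p≺r , from T-ltb⇔ r≺q)))
    (λ (p≺q , none) → from T-∧ (from T-ltb⇔ p≺q , from (T-all-allFin⇔ _) λ r →
      from T-not⇔ λ t → let p<r , r<q = to T-∧ t in none r (to T-ltb⇔ p<r) (to T-ltb⇔ r<q)))

  ¬⋖⇒∃-between : ∀ {q p} → q ≺ p → ¬ q ⋖ p → ∃[ r ] q ≺ r × r ≺ p
  ¬⋖⇒∃-between {q} {p} q≺p q⋪p =
    let r , between = Finₚ.¬∀⟶∃¬ n (T ∘ notBetween) (T? ∘ notBetween) ¬none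
        q<r , r<p = to T-∧ (decidable-stable (T? _) (between ∘ from T-not⇔))
    in r , to T-ltb⇔ q<r , to T-ltb⇔ r<p
    where
    notBetween : Fin n → Bool
    notBetween r = not (ltb P q r ∧ ltb P r p)
    ¬none : ¬ (∀ r → T (notBetween r))
    ¬none none =
      q⋪p (to T-coversᵇ⇔ (from T-∧ (from T-ltb⇔ q≺p , from (T-all-allFin⇔ notBetween) none)))

  IsIdeal : Vec Bool n → Set
  IsIdeal I = ∀ {p q} → q ≼ p → T (lookup I p) → T (lookup I q)

  T-isIdealᵇ⇔ : ∀ {I} → T (isIdealᵇ P I) ⇔ IsIdeal I
  T-isIdealᵇ⇔ {I} = mk⇔
    (λ t {p} {q} q≼p p∈I → decidable-stable (T? _) λ q∉I →
      to T-not⇔ (to (T-all-allFin⇔ _) (to (T-all-allFin⇔ _) t p) q)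
        (from T-∧ (from T-leb⇔ q≼p , from T-∧ (p∈I , from T-not⇔ q∉I))))
    (λ ideal → from (T-all-allFin⇔ (λ p → all (closedAt p) (elems P))) λ p →
      from (T-all-allFin⇔ (closedAt p)) λ q → from T-not⇔ λ t →
      let q≤p , p∈I×q∉I = to T-∧ t ; p∈I , q∉I = to T-∧ p∈I×q∉I in
      to T-not⇔ q∉I (ideal (to T-leb⇔ q≤p) p∈I))
    where
    closedAt : Fin n → Fin n → Bool
    closedAt p q = not (leb P q p ∧ lookup I p ∧ not (lookup I q))

  addable : Vec Bool n → Fin n → Bool
  addable I p = not (lookup I p) ∧ isIdealᵇ P (I [ p ]≔ true)

  removable : Vec Bool n → Fin n → Bool
  removable I p = lookup I p ∧ isIdealᵇ P (I [ p ]≔ false)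

  module _ {I : Vec Bool n} (ideal : IsIdeal I) {p : Fin n} where

    T-addable⇔ : T (addable I p) ⇔ (¬ T (lookup I p) × ∀ q → q ≺ p → T (lookup I q))
    T-addable⇔ = mk⇔
      (λ t → let p∉I , ideal⁺ = to T-∧ t in to T-not⇔ p∉I , below (to (T-isIdealᵇ⇔ {I⁺}) ideal⁺))
      (λ (p∉I , below) → from T-∧ (from T-not⇔ p∉I , from (T-isIdealᵇ⇔ {I⁺}) (ideal⁺ below)))
      where
      I⁺ : Vec Bool n
      I⁺ = I [ p ]≔ true
      p∈I⁺ : T (lookup I⁺ p)
      p∈I⁺ = subst T (sym (Vecₚ.lookup∘update p I true)) _
      below : IsIdeal I⁺ → ∀ q → q ≺ p → T (lookup I q)
      below ideal⁺ q (q≼p , q≢p) = subst T (Vecₚ.lookup∘update′ q≢p I true) (ideal⁺ q≼p p∈I⁺)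
      ideal⁺ : (∀ q → q ≺ p → T (lookup I q)) → IsIdeal I⁺
      ideal⁺ below {s} {r} r≼s s∈I⁺ with r Fin.≟ p | s Fin.≟ p
      ... | yes refl | _        = p∈I⁺
      ... | no r≢p   | yes refl = subst T (sym (Vecₚ.lookup∘update′ r≢p I true)) (below r (r≼s , r≢p))
      ... | no r≢p   | no s≢p   = subst T (sym (Vecₚ.lookup∘update′ r≢p I true))
                                    (ideal r≼s (subst T (Vecₚ.lookup∘update′ s≢p I true) s∈I⁺))

    T-removable⇔ : T (removable I p) ⇔ (T (lookup I p) × ∀ q → p ≺ q → ¬ T (lookup I q))
    T-removable⇔ = mk⇔
      (λ t → let p∈I , ideal⁻ = to T-∧ t in p∈I , above (to (T-isIdealᵇ⇔ {I⁻}) ideal⁻))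
      (λ (p∈I , above) → from T-∧ (p∈I , from (T-isIdealᵇ⇔ {I⁻}) (ideal⁻ above)))
      where
      I⁻ : Vec Bool n
      I⁻ = I [ p ]≔ false
      p∉I⁻ : ¬ T (lookup I⁻ p)
      p∉I⁻ = subst T (Vecₚ.lookup∘update p I false)
      above : IsIdeal I⁻ → ∀ q → p ≺ q → ¬ T (lookup I q)
      above ideal⁻ q (p≼q , p≢q) q∈I =
        p∉I⁻ (ideal⁻ p≼q (subst T (sym (Vecₚ.lookup∘update′ (p≢q ∘ sym) I false)) q∈I))
      ideal⁻ : (∀ q → p ≺ q → ¬ T (lookup I q)) → IsIdeal I⁻
      ideal⁻ above {s} {r} r≼s s∈I⁻ with s Fin.≟ p | r Fin.≟ p
      ... | yes refl | _        = ⊥-elim (p∉I⁻ s∈I⁻)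
      ... | no s≢p   | yes refl = ⊥-elim (above s (r≼s , s≢p ∘ sym) s∈I)
        where
        s∈I : T (lookup I s)
        s∈I = subst T (Vecₚ.lookup∘update′ s≢p I false) s∈I⁻
      ... | no s≢p   | no r≢p   = subst T (sym (Vecₚ.lookup∘update′ r≢p I false))
                                    (ideal r≼s (subst T (Vecₚ.lookup∘update′ s≢p I false) s∈I⁻))

  module _ (L : LinearExtension P) where
    open LinearExtension L

    position : Fin n → ℕ
    position p = toℕ (index (complete p))

    position-mono : ∀ {p q} → p ≺ q → position p < position q
    position-mono {p} {q} (p≼q , p≢q) =
      ℕₚ.≤∧≢⇒< (respects _ _ (subst₂ _≼_ p≡ q≡ p≼q)) (p≢q ∘ same)
      where
      p≡ : p ≡ List.lookup list (index (complete p))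
      p≡ = Anyₚ.lookup-index (complete p)
      q≡ : q ≡ List.lookup list (index (complete q))
      q≡ = Anyₚ.lookup-index (complete q)
      same : position p ≡ position q → p ≡ q
      same eq = trans p≡ (trans (cong (List.lookup list) (Finₚ.toℕ-injective eq)) (sym q≡))

    -- Induction on the distance between q and p in the linear extension.
    ⋖-within : ∀ fuel {q p} → position p ∸ position q ≤ fuel → q ≺ p →
               (∃[ c ] q ≼ c × c ⋖ p) × (∃[ c ] q ⋖ c × c ≼ p)
    ⋖-within fuel {q} {p} bound q≺p with T? (coversᵇ P p q)
    ... | yes t = (q , ≼-refl , to T-coversᵇ⇔ t) , (p , to T-coversᵇ⇔ t , ≼-refl)
    ... | no ¬t with fuel | ¬⋖⇒∃-between q≺p (¬t ∘ from T-coversᵇ⇔)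
    ...   | zero | _ =
      ⊥-elim (ℕₚ.<⇒≢ (ℕₚ.m<n⇒0<n∸m (position-mono q≺p)) (sym (ℕₚ.n≤0⇒n≡0 bound)))
    ...   | suc fuel | r , q≺r , r≺p =
      let (c , r≼c , c⋖p) , _ = ⋖-within fuel upper r≺p
          _ , (d , q⋖d , d≼r) = ⋖-within fuel lower q≺r
      in (c , ≼-trans (proj₁ q≺r) r≼c , c⋖p) , (d , q⋖d , ≼-trans d≼r (proj₁ r≺p))
      where
      upper : position p ∸ position r ≤ fuel
      upper = ℕₚ.<⇒≤pred (ℕₚ.<-≤-trans
        (ℕₚ.∸-monoʳ-< (position-mono q≺r) (ℕₚ.<⇒≤ (position-mono r≺p))) bound)
      lower : position r ∸ position q ≤ fuel
      lower = ℕₚ.<⇒≤pred (ℕₚ.<-≤-trans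
        (ℕₚ.∸-monoˡ-< (position-mono r≺p) (ℕₚ.<⇒≤ (position-mono q≺r))) bound)

    ≺⇒≼⋖ : ∀ {q p} → q ≺ p → ∃[ c ] q ≼ c × c ⋖ p
    ≺⇒≼⋖ = proj₁ ∘ ⋖-within _ ℕₚ.≤-refl

    ≺⇒⋖≼ : ∀ {q p} → q ≺ p → ∃[ c ] q ⋖ c × c ≼ p
    ≺⇒⋖≼ = proj₂ ∘ ⋖-within _ ℕₚ.≤-refl

    later-not-below : AllPairs (λ x y → ¬ y ≼ x) list
    later-not-below = go list respects
      where
      go : ∀ xs → (∀ i j → List.lookup xs i ≼ List.lookup xs j → i Fin.≤ j) →
           AllPairs (λ x y → ¬ y ≼ x) xs
      go []       _       = []
      go (x ∷ xs) ordered =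
        All.tabulate head-minimal ∷ go xs (λ i j → ℕₚ.≤-pred ∘ ordered (Fin.suc i) (Fin.suc j))
        where
        head-minimal : ∀ {y} → y ∈ xs → ¬ y ≼ x
        head-minimal y∈xs y≼x
          with ordered (Fin.suc (index y∈xs)) Fin.zero (subst (_≼ x) (Anyₚ.lookup-index y∈xs) y≼x)
        ... | ()

-- Integer toggles and rowmotion

module Toggles (P : FinPoset) (L : LinearExtension P) (ℓ : ℕ) where
  open FinPoset P
  open Order P
  open LinearExtension L

  upperCovers : Fin n → List (Fin n)
  upperCovers p = filterᵇ (λ q → coversᵇ P q p) (elems P)

  lowerCovers : Fin n → List (Fin n)
  lowerCovers p = filterᵇ (λ q → coversᵇ P p q) (elems P)

  ∈-upperCovers⇔ : ∀ {p c} → c ∈ upperCovers p ⇔ p ⋖ c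
  ∈-upperCovers⇔ {p} {c} = mk⇔
    (to T-coversᵇ⇔ ∘ proj₂ ∘ ∈-filter⁻ (T? ∘ λ q → coversᵇ P q p) {xs = elems P})
    (∈-filter⁺ (T? ∘ λ q → coversᵇ P q p) (∈-allFin c) ∘ from T-coversᵇ⇔)

  ∈-lowerCovers⇔ : ∀ {p c} → c ∈ lowerCovers p ⇔ c ⋖ p
  ∈-lowerCovers⇔ {p} {c} = mk⇔
    (to T-coversᵇ⇔ ∘ proj₂ ∘ ∈-filter⁻ (T? ∘ coversᵇ P p) {xs = elems P})
    (∈-filter⁺ (T? ∘ coversᵇ P p) (∈-allFin c) ∘ from T-coversᵇ⇔)

  upperℕ : (Fin n → ℕ) → Fin n → ℕ
  upperℕ S p = minOrℕ ℓ (map S (upperCovers p))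

  lowerℕ : (Fin n → ℕ) → Fin n → ℕ
  lowerℕ S p = maxOrℕ 0 (map S (lowerCovers p))

  -- ℓ · τ^PL_p (f / ℓ) for integer f: ℓ and 0 play the roles of f(1̂) = 1 and f(0̂) = 0.
  τℕ : Fin n → (Fin n → ℕ) → (Fin n → ℕ)
  τℕ p S q = if does (q Fin.≟ p) then upperℕ S p + lowerℕ S p ∸ S p else S q

  rowℕ : (Fin n → ℕ) → (Fin n → ℕ)
  rowℕ S = foldr τℕ S list

  PP : (Fin n → ℕ) → Set
  PP = IsPP P ℓ

  upperℕ-greatest : ∀ {S p b} → b ≤ ℓ → (∀ q → p ≺ q → b ≤ S q) → b ≤ upperℕ S p
  upperℕ-greatest {S} {p} b≤ℓ above = ≤-minOrℕ (map S (upperCovers p)) b≤ℓ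
    (map⁺ (All.tabulate λ c∈ → above _ (proj₁ (to ∈-upperCovers⇔ c∈))))

  lowerℕ-least : ∀ {S p b} → (∀ q → q ≺ p → S q ≤ b) → lowerℕ S p ≤ b
  lowerℕ-least {S} {p} below = maxOrℕ-≤ (map S (lowerCovers p)) z≤n
    (map⁺ (All.tabulate λ c∈ → below _ (proj₁ (to ∈-lowerCovers⇔ c∈))))

  upperℕ-cong : ∀ {S S′} p → (∀ c → p ⋖ c → S c ≡ S′ c) → upperℕ S p ≡ upperℕ S′ p
  upperℕ-cong p same = cong (minOrℕ ℓ) (Listₚ.map-cong-local
    (All.tabulate λ c∈ → same _ (to ∈-upperCovers⇔ c∈)))

  lowerℕ-cong : ∀ {S S′} p → (∀ c → c ⋖ p → S c ≡ S′ c) → lowerℕ S p ≡ lowerℕ S′ p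
  lowerℕ-cong p same = cong (maxOrℕ 0) (Listₚ.map-cong-local
    (All.tabulate λ c∈ → same _ (to ∈-lowerCovers⇔ c∈)))

  module _ {S : Fin n → ℕ} (pp : PP S) where

    ≺⇒≤lowerℕ : ∀ {q p} → q ≺ p → S q ≤ lowerℕ S p
    ≺⇒≤lowerℕ {q} {p} q≺p = let c , q≼c , c⋖p = ≺⇒≼⋖ L q≺p in
      ℕₚ.≤-trans (proj₂ pp q c q≼c)
                 (∈⇒≤-maxOrℕ (map S (lowerCovers p)) (∈-map⁺ S (from ∈-lowerCovers⇔ c⋖p)))

    ≺⇒upperℕ≤ : ∀ {p q} → p ≺ q → upperℕ S p ≤ S q
    ≺⇒upperℕ≤ {p} {q} p≺q = let c , p⋖c , c≼q = ≺⇒⋖≼ L p≺q in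
      ℕₚ.≤-trans (∈⇒minOrℕ-≤ (map S (upperCovers p)) (∈-map⁺ S (from ∈-upperCovers⇔ p⋖c)))
                 (proj₂ pp c q c≼q)

    lowerℕ≤ : ∀ p → lowerℕ S p ≤ S p
    lowerℕ≤ p = lowerℕ-least λ q q≺p → proj₂ pp q p (proj₁ q≺p)

    ≤upperℕ : ∀ p → S p ≤ upperℕ S p
    ≤upperℕ p = upperℕ-greatest (proj₁ pp p) λ q p≺q → proj₂ pp p q (proj₁ p≺q)

    upperℕ≤ℓ : ∀ p → upperℕ S p ≤ ℓ
    upperℕ≤ℓ p = minOrℕ-≤ ℓ (map S (upperCovers p)) ℕₚ.≤-refl
      (map⁺ (All.tabulate λ {c} _ → proj₁ pp c))

  τℕ-at : ∀ p S → τℕ p S p ≡ upperℕ S p + lowerℕ S p ∸ S p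
  τℕ-at p S with p Fin.≟ p
  ... | yes _   = refl
  ... | no p≢p = ⊥-elim (p≢p refl)

  τℕ-elsewhere : ∀ {p q} S → q ≢ p → τℕ p S q ≡ S q
  τℕ-elsewhere {p} {q} S q≢p with q Fin.≟ p
  ... | yes q≡p = ⊥-elim (q≢p q≡p)
  ... | no _    = refl

  τℕ-PP : ∀ p {S} → PP S → PP (τℕ p S)
  τℕ-PP p {S} pp = bounded , monotone
    where
    new≤upper : upperℕ S p + lowerℕ S p ∸ S p ≤ upperℕ S p
    new≤upper = l≤x⇒u+l∸x≤u (lowerℕ≤ pp p)
    lower≤new : lowerℕ S p ≤ upperℕ S p + lowerℕ S p ∸ S p
    lower≤new = x≤u⇒l≤u+l∸x (≤upperℕ pp p)
    bounded : ∀ q → τℕ p S q ≤ ℓ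
    bounded q with q Fin.≟ p
    ... | yes refl = ℕₚ.≤-trans new≤upper (upperℕ≤ℓ pp p)
    ... | no _     = proj₁ pp q
    monotone : ∀ q r → q ≼ r → τℕ p S q ≤ τℕ p S r
    monotone q r q≼r with q Fin.≟ p | r Fin.≟ p
    ... | yes refl | yes refl = ℕₚ.≤-refl
    ... | yes refl | no r≢q   = ℕₚ.≤-trans new≤upper (≺⇒upperℕ≤ pp (q≼r , r≢q ∘ sym))
    ... | no q≢r   | yes refl = ℕₚ.≤-trans (≺⇒≤lowerℕ pp (q≼r , q≢r)) lower≤new
    ... | no _     | no _     = proj₂ pp q r q≼r

  foldr-τℕ-PP : ∀ xs {S} → PP S → PP (foldr τℕ S xs)
  foldr-τℕ-PP []       pp = pp
  foldr-τℕ-PP (x ∷ xs) pp = τℕ-PP x (foldr-τℕ-PP xs pp)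

  foldr-τℕ-∉ : ∀ xs {S q} → q ∉ xs → foldr τℕ S xs q ≡ S q
  foldr-τℕ-∉ []       q∉ = refl
  foldr-τℕ-∉ (x ∷ xs) {S} q∉ =
    trans (τℕ-elsewhere (foldr τℕ S xs) (q∉ ∘ here)) (foldr-τℕ-∉ xs (q∉ ∘ there))

  -- Toggling starts at the end of the list: when x is toggled, everything above x already
  -- carries its new value and everything below x its old one.
  foldr-τℕ-recurrence : ∀ xs → AllPairs (λ x y → ¬ y ≼ x) xs →
    ∀ {S} → PP S → ∀ {p} → p ∈ xs → foldr τℕ S xs p + S p ≡ upperℕ (foldr τℕ S xs) p + lowerℕ S p
  foldr-τℕ-recurrence (x ∷ xs) (minimal ∷ _) {S} pp (here refl) = begin
    τℕ x F x + S x
      ≡⟨ cong (_+ S x) (τℕ-at x F) ⟩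
    upperℕ F x + lowerℕ F x ∸ F x + S x
      ≡⟨ cong₂ (λ l v → upperℕ F x + l ∸ v + S x) lower-same x-unchanged ⟩
    upperℕ F x + lowerℕ S x ∸ S x + S x
      ≡⟨ ℕₚ.m∸n+n≡m (ℕₚ.≤-trans Sx≤upper (ℕₚ.m≤m+n _ _)) ⟩
    upperℕ F x + lowerℕ S x
      ≡⟨ cong (_+ lowerℕ S x) upper-same ⟩
    upperℕ (τℕ x F) x + lowerℕ S x ∎
    where
    open ≡-Reasoning
    F : Fin n → ℕ
    F = foldr τℕ S xs
    untouched : ∀ {q} → q ≼ x → F q ≡ S q
    untouched q≼x = foldr-τℕ-∉ xs λ q∈ → All.lookup minimal q∈ q≼x
    x-unchanged : F x ≡ S x
    x-unchanged = untouched ≼-refl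
    lower-same : lowerℕ F x ≡ lowerℕ S x
    lower-same = lowerℕ-cong x λ c c⋖x → untouched (proj₁ (proj₁ c⋖x))
    Sx≤upper : S x ≤ upperℕ F x
    Sx≤upper = subst (_≤ upperℕ F x) x-unchanged (≤upperℕ (foldr-τℕ-PP xs pp) x)
    upper-same : upperℕ F x ≡ upperℕ (τℕ x F) x
    upper-same = upperℕ-cong x λ c x⋖c → sym (τℕ-elsewhere F (proj₂ (proj₁ x⋖c) ∘ sym))
  foldr-τℕ-recurrence (x ∷ xs) (minimal ∷ ordered) {S} pp {p} (there p∈) = begin
    τℕ x F p + S p                  ≡⟨ cong (_+ S p) (τℕ-elsewhere F p≢x) ⟩
    F p + S p                       ≡⟨ foldr-τℕ-recurrence xs ordered pp p∈ ⟩
    upperℕ F p + lowerℕ S p         ≡⟨ cong (_+ lowerℕ S p) upper-same ⟩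
    upperℕ (τℕ x F) p + lowerℕ S p  ∎
    where
    open ≡-Reasoning
    F : Fin n → ℕ
    F = foldr τℕ S xs
    p⋠x : ¬ p ≼ x
    p⋠x = All.lookup minimal p∈
    p≢x : p ≢ x
    p≢x refl = p⋠x ≼-refl
    upper-same : upperℕ F p ≡ upperℕ (τℕ x F) p
    upper-same = upperℕ-cong p λ c p⋖c →
      sym (τℕ-elsewhere F λ { refl → p⋠x (proj₁ (proj₁ p⋖c)) })

  rowℕ-PP : ∀ {S} → PP S → PP (rowℕ S)
  rowℕ-PP = foldr-τℕ-PP list

  rowℕ-recurrence : ∀ {S} → PP S → ∀ p → rowℕ S p + S p ≡ upperℕ (rowℕ S) p + lowerℕ S p
  rowℕ-recurrence pp p = foldr-τℕ-recurrence list (later-not-below L) pp (complete p)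

-- Piecewise-linear rowmotion on ℓ-scaled P-partitions

module Scaling (P : FinPoset) (L : LinearExtension P) (m : ℕ) where
  open FinPoset P
  open Toggles P L (suc m)

  1/ℓ : ℚ
  1/ℓ = ℤ.+ 1 ℚ./ suc m

  scale : ℕ → ℚ
  scale a = divℕ (fromℕ a) (suc m)

  scale-mono : ∀ {a b} → a ≤ b → scale a ℚ.≤ scale b
  scale-mono a≤b = ℚₚ.*-monoʳ-≤-nonNeg 1/ℓ {{ℚₚ.normalize-nonNeg 1 (suc m)}} (fromℕ-mono-≤ a≤b)

  scale-ℓ : scale (suc m) ≡ 1ℚ
  scale-ℓ = fromℕ-*-inverse m

  ℓ*scale : ∀ a → fromℕ (suc m) * scale a ≡ fromℕ a
  ℓ*scale a = begin
    fromℕ (suc m) * (fromℕ a * 1/ℓ)  ≡⟨ swap (fromℕ (suc m)) (fromℕ a) 1/ℓ ⟩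
    fromℕ a * (fromℕ (suc m) * 1/ℓ)  ≡⟨ cong (fromℕ a *_) scale-ℓ ⟩
    fromℕ a * 1ℚ                       ≡⟨ ℚₚ.*-identityʳ (fromℕ a) ⟩
    fromℕ a                              ∎
    where
    open ≡-Reasoning
    open +-*-Solver
    swap : ∀ x y z → x * (y * z) ≡ y * (x * z)
    swap = solve 3 (λ x y z → x :* (y :* z) := y :* (x :* z)) refl

  scale-reflect : ∀ u l t → t ≤ u + l → scale u ℚ.+ scale l ℚ.- scale t ≡ scale (u + l ∸ t)
  scale-reflect u l t t≤u+l = begin
    scale u ℚ.+ scale l ℚ.- scale t
      ≡⟨ factor (fromℕ u) (fromℕ l) (fromℕ t) 1/ℓ ⟩
    (fromℕ u ℚ.+ fromℕ l ℚ.- fromℕ t) * 1/ℓ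
      ≡⟨ cong (λ x → (x ℚ.- fromℕ t) * 1/ℓ) (fromℕ-+ u l) ⟨
    (fromℕ (u + l) ℚ.- fromℕ t) * 1/ℓ
      ≡⟨ cong (λ x → (fromℕ x ℚ.- fromℕ t) * 1/ℓ) (ℕₚ.m∸n+n≡m t≤u+l) ⟨
    (fromℕ (u + l ∸ t + t) ℚ.- fromℕ t) * 1/ℓ
      ≡⟨ cong (λ x → (x ℚ.- fromℕ t) * 1/ℓ) (fromℕ-+ (u + l ∸ t) t) ⟩
    (fromℕ (u + l ∸ t) ℚ.+ fromℕ t ℚ.- fromℕ t) * 1/ℓ
      ≡⟨ cancel (fromℕ (u + l ∸ t)) (fromℕ t) 1/ℓ ⟩
    scale (u + l ∸ t) ∎
    where
    open ≡-Reasoning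
    open +-*-Solver
    factor : ∀ a b c i → a * i ℚ.+ b * i ℚ.- c * i ≡ (a ℚ.+ b ℚ.- c) * i
    factor = solve 4 (λ a b c i → a :* i :+ b :* i :- c :* i := (a :+ b :- c) :* i) refl
    cancel : ∀ a c i → (a ℚ.+ c ℚ.- c) * i ≡ a * i
    cancel = solve 3 (λ a c i → (a :+ c :- c) :* i := a :* i) refl

  upperPL-scale : ∀ S p → upperPL P (scale ∘ S) p ≡ scale (upperℕ S p)
  upperPL-scale S p =
    trans (cong₂ minOr (sym scale-ℓ) (Listₚ.map-∘ (upperCovers p)))
          (minOr-map-mono scale scale-mono (suc m) (map S (upperCovers p)))

  lowerPL-scale : ∀ S p → lowerPL P (scale ∘ S) p ≡ scale (lowerℕ S p)
  lowerPL-scale S p =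
    trans (cong₂ maxOr (sym (ℚₚ.*-zeroˡ 1/ℓ)) (Listₚ.map-∘ (lowerCovers p)))
          (maxOr-map-mono scale scale-mono 0 (map S (lowerCovers p)))

  τPL-cong : ∀ p {f g : Fin n → ℚ} → f ≗ g → τPL P p f ≗ τPL P p g
  τPL-cong p {f} {g} f≗g q with q Fin.≟ p
  ... | yes _ = trans (cong (λ x → upperPL P f p ℚ.+ lowerPL P f p ℚ.- x) (f≗g p))
                      (cong₂ (λ u l → u ℚ.+ l ℚ.- g p)
                        (cong (minOr 1ℚ) (Listₚ.map-cong f≗g (upperCovers p)))
                        (cong (maxOr 0ℚ) (Listₚ.map-cong f≗g (lowerCovers p))))
  ... | no _  = f≗g q

  τPL-scale : ∀ p {S} → PP S → τPL P p (scale ∘ S) ≗ scale ∘ τℕ p S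
  τPL-scale p {S} pp q = trans (if-cong-then (does (q Fin.≟ p)) toggled)
                               (sym (if-float scale (does (q Fin.≟ p))))
    where
    toggled : upperPL P (scale ∘ S) p ℚ.+ lowerPL P (scale ∘ S) p ℚ.- scale (S p)
            ≡ scale (upperℕ S p + lowerℕ S p ∸ S p)
    toggled = trans
      (cong₂ (λ u l → u ℚ.+ l ℚ.- scale (S p)) (upperPL-scale S p) (lowerPL-scale S p))
      (scale-reflect (upperℕ S p) (lowerℕ S p) (S p) (ℕₚ.≤-trans (≤upperℕ pp p) (ℕₚ.m≤m+n _ _)))

  foldr-τPL-scale : ∀ xs {S} {f : Fin n → ℚ} → PP S → f ≗ scale ∘ S →
                    foldr (τPL P) f xs ≗ scale ∘ foldr τℕ S xs
  foldr-τPL-scale []       pp f≗ = f≗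
  foldr-τPL-scale (x ∷ xs) pp f≗ q =
    trans (τPL-cong x (foldr-τPL-scale xs pp f≗) q) (τPL-scale x (foldr-τℕ-PP xs pp) q)

  row-embed : ∀ {S} {f : Fin n → ℚ} → PP S → f ≗ embed P S → row P L (suc m) f ≗ embed P (rowℕ S)
  row-embed {S} {f} pp f≗ q = trans
    (cong (fromℕ (suc m) *_) (foldr-τPL-scale (LinearExtension.list L) pp scaled q))
    (ℓ*scale (rowℕ S q))
    where
    scaled : (λ r → divℕ (f r) (suc m)) ≗ scale ∘ S
    scaled r = cong (λ x → divℕ x (suc m)) (f≗ r)

  iter-rowℕ-PP : ∀ j {S} → PP S → PP (iter rowℕ j S)
  iter-rowℕ-PP zero    pp = pp
  iter-rowℕ-PP (suc j) pp = rowℕ-PP (iter-rowℕ-PP j pp)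

  iter-row-embed : ∀ j {S} → PP S → iter (row P L (suc m)) j (embed P S) ≗ embed P (iter rowℕ j S)
  iter-row-embed zero    pp q = refl
  iter-row-embed (suc j) pp q = row-embed (iter-rowℕ-PP j pp) (iter-row-embed j pp) q

-- Toggleability of sublevel ideals

module Sublevels (P : FinPoset) (L : LinearExtension P) (ℓ : ℕ) where
  open FinPoset P
  open Order P
  open Toggles P L ℓ

  sublevel : (Fin n → ℕ) → ℕ → Vec Bool n
  sublevel S i = tabulate (λ q → S q ℕ.≤ᵇ i)

  T-sublevel⇔ : ∀ S {i q} → T (lookup (sublevel S i) q) ⇔ S q ≤ i
  T-sublevel⇔ S {i} {q} = mk⇔
    (ℕₚ.≤ᵇ⇒≤ (S q) i ∘ subst T (Vecₚ.lookup∘tabulate _ q))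
    (subst T (sym (Vecₚ.lookup∘tabulate _ q)) ∘ ℕₚ.≤⇒≤ᵇ)

  sublevel-ideal : ∀ {S} → PP S → ∀ i → IsIdeal (sublevel S i)
  sublevel-ideal {S} pp i {p} {q} q≼p p∈ =
    from (T-sublevel⇔ S) (ℕₚ.≤-trans (proj₂ pp q p q≼p) (to (T-sublevel⇔ S) p∈))

  module _ {S : Fin n → ℕ} (pp : PP S) {p : Fin n} where

    private
      S≤⇔ : ∀ {i q} → T (lookup (sublevel S i) q) ⇔ S q ≤ i
      S≤⇔ = T-sublevel⇔ S

    addable-sublevel : ∀ i → addable (sublevel S i) p ≡ (lowerℕ S p ℕ.≤ᵇ i) ∧ (i ℕ.<ᵇ S p)
    addable-sublevel i = T-injective (mk⇔
      (λ t → let p∉ , below = to (T-addable⇔ {I = sublevel S i} (sublevel-ideal pp i)) t in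
        from T-∧ ( ℕₚ.≤⇒≤ᵇ (lowerℕ-least λ q q≺p → to S≤⇔ (below q q≺p))
                 , ℕₚ.<⇒<ᵇ (ℕₚ.≰⇒> (p∉ ∘ from S≤⇔))))
      (λ t → let lower≤i , i<Sp = to T-∧ t in
        from (T-addable⇔ {I = sublevel S i} (sublevel-ideal pp i))
          ( ℕₚ.<⇒≱ (ℕₚ.<ᵇ⇒< i (S p) i<Sp) ∘ to S≤⇔
          , λ q q≺p → from S≤⇔ (ℕₚ.≤-trans (≺⇒≤lowerℕ pp q≺p) (ℕₚ.≤ᵇ⇒≤ _ i lower≤i)))))

    removable-sublevel : ∀ {i} → i < ℓ →
                         removable (sublevel S i) p ≡ (S p ℕ.≤ᵇ i) ∧ (i ℕ.<ᵇ upperℕ S p)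
    removable-sublevel {i} i<ℓ = T-injective (mk⇔
      (λ t → let p∈ , above = to (T-removable⇔ {I = sublevel S i} (sublevel-ideal pp i)) t in
        from T-∧ ( ℕₚ.≤⇒≤ᵇ (to S≤⇔ p∈)
                 , ℕₚ.<⇒<ᵇ (upperℕ-greatest i<ℓ λ q p≺q → ℕₚ.≰⇒> (above q p≺q ∘ from S≤⇔))))
      (λ t → let Sp≤i , i<upper = to T-∧ t in
        from (T-removable⇔ {I = sublevel S i} (sublevel-ideal pp i))
          ( from S≤⇔ (ℕₚ.≤ᵇ⇒≤ (S p) i Sp≤i)
          , λ q p≺q q∈ → ℕₚ.<⇒≱ (ℕₚ.<-≤-trans (ℕₚ.<ᵇ⇒< i _ i<upper) (≺⇒upperℕ≤ pp p≺q))
                                 (to S≤⇔ q∈))))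

    addable-count : sum (map (λ i → indicator (addable (sublevel S i) p)) (upTo ℓ)) + lowerℕ S p ≡ S p
    addable-count = trans
      (cong (λ xs → sum xs + lowerℕ S p) (Listₚ.map-cong (cong indicator ∘ addable-sublevel) (upTo ℓ)))
      (count-interval ℓ (lowerℕ≤ pp p) (proj₁ pp p))

    removable-count : sum (map (λ i → indicator (removable (sublevel S i) p)) (upTo ℓ)) + S p ≡ upperℕ S p
    removable-count = trans
      (cong (λ xs → sum xs + S p) (Listₚ.map-cong-local
        (All.tabulate λ i∈ → cong indicator (removable-sublevel (∈-upTo⁻ i∈)))))
      (count-interval ℓ (≤upperℕ pp p) (upperℕ≤ℓ pp p))

𝒯≡addable-removable : ∀ P p I →
  𝒯 P p I ≡ fromℕ (indicator (Order.addable P I p)) ℚ.- fromℕ (indicator (Order.removable P I p))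
𝒯≡addable-removable P p I
  with lookup I p | isIdealᵇ P (I [ p ]≔ true) | isIdealᵇ P (I [ p ]≔ false)
... | true  | _     | true  = refl
... | true  | _     | false = refl
... | false | true  | _     = refl
... | false | false | _     = refl

-- Empirical distributions on J(P)

_≟ᵛ_ : ∀ {n} (u v : Vec Bool n) → Dec (u ≡ v)
_≟ᵛ_ = Vecₚ.≡-dec Boolₚ._≟_

does-≟ᵛ-sym : ∀ {n} (u v : Vec Bool n) → does (u ≟ᵛ v) ≡ does (v ≟ᵛ u)
does-≟ᵛ-sym u v with u ≟ᵛ v | v ≟ᵛ u
... | yes _   | yes _   = refl
... | no _    | no _    = refl
... | yes u≡v | no v≢u = ⊥-elim (v≢u (sym u≡v))
... | no u≢v  | yes v≡u = ⊥-elim (u≢v (sym v≡u))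

occurrences : ∀ {n} → Vec Bool n → List (Vec Bool n) → ℕ
occurrences x us = sum (map (λ u → indicator (does (u ≟ᵛ x))) us)

occurrences-allSubsets : ∀ {n} (x : Vec Bool n) → occurrences x (allSubsets n) ≡ 1
occurrences-allSubsets {zero}  Vec.[]      = refl
occurrences-allSubsets {suc n} (b Vec.∷ x) = begin
  occurrences (b Vec.∷ x) (map (true Vec.∷_) A ++ map (false Vec.∷_) A)
    ≡⟨ cong sum (Listₚ.map-++ same (map (true Vec.∷_) A) (map (false Vec.∷_) A)) ⟩
  sum (map same (map (true Vec.∷_) A) ++ map same (map (false Vec.∷_) A))
    ≡⟨ sum-++ (map same (map (true Vec.∷_) A)) _ ⟩
  sum (map same (map (true Vec.∷_) A)) + sum (map same (map (false Vec.∷_) A))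
    ≡⟨ cong₂ _+_ (cong sum (Listₚ.map-∘ A)) (cong sum (Listₚ.map-∘ A)) ⟨
  sum (map (same ∘ (true Vec.∷_)) A) + sum (map (same ∘ (false Vec.∷_)) A)
    ≡⟨ split b ⟩
  1 ∎
  where
  open ≡-Reasoning
  A = allSubsets n
  same : Vec Bool (suc n) → ℕ
  same u = indicator (does (u ≟ᵛ (b Vec.∷ x)))
  split : ∀ b → sum (map (λ u → indicator (does ((true Vec.∷ u) ≟ᵛ (b Vec.∷ x)))) A)
              + sum (map (λ u → indicator (does ((false Vec.∷ u) ≟ᵛ (b Vec.∷ x)))) A) ≡ 1
  split true  = cong₂ _+_ (occurrences-allSubsets x) (sum-map-zero A)
  split false = cong₂ _+_ (sum-map-zero A) (occurrences-allSubsets x)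

occurrences-filter : ∀ {n} (f : Vec Bool n → Bool) {x} → T (f x) → ∀ us →
                     occurrences x (filterᵇ f us) ≡ occurrences x us
occurrences-filter f fx []       = refl
occurrences-filter f {x} fx (u ∷ us) with f u in fu
... | true  = cong (indicator (does (u ≟ᵛ x)) +_) (occurrences-filter f fx us)
... | false with u ≟ᵛ x
...   | yes refl = ⊥-elim (subst T fu fx)
...   | no _     = occurrences-filter f fx us

module Empirical (P : FinPoset) where
  open FinPoset P

  occurrences-ideals : ∀ {x} → T (isIdealᵇ P x) → occurrences x (ideals P) ≡ 1
  occurrences-ideals {x} ideal =
    trans (occurrences-filter (isIdealᵇ P) ideal (allSubsets n)) (occurrences-allSubsets x)

  weighted-occurrences : ∀ (f : Vec Bool n → ℚ) x us →
    sumℚ (map (λ u → fromℕ (indicator (does (u ≟ᵛ x))) * f u) us) ≡ fromℕ (occurrences x us) * f x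
  weighted-occurrences f x []       = sym (ℚₚ.*-zeroˡ (f x))
  weighted-occurrences f x (u ∷ us) = begin
    fromℕ (same u) * f u ℚ.+ sumℚ (map (λ u → fromℕ (same u) * f u) us)
      ≡⟨ cong₂ ℚ._+_ head (weighted-occurrences f x us) ⟩
    fromℕ (same u) * f x ℚ.+ fromℕ (occurrences x us) * f x
      ≡⟨ ℚₚ.*-distribʳ-+ (f x) (fromℕ (same u)) _ ⟨
    (fromℕ (same u) ℚ.+ fromℕ (occurrences x us)) * f x
      ≡⟨ cong (_* f x) (fromℕ-+ (same u) _) ⟨
    fromℕ (occurrences x (u ∷ us)) * f x ∎
    where
    open ≡-Reasoning
    same : Vec Bool n → ℕ
    same u = indicator (does (u ≟ᵛ x))
    head : fromℕ (same u) * f u ≡ fromℕ (same u) * f x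
    head with u ≟ᵛ x
    ... | yes refl = refl
    ... | no _     = trans (ℚₚ.*-zeroˡ (f u)) (sym (ℚₚ.*-zeroˡ (f x)))

  empirical : ℚ → List (Vec Bool n) → Vec Bool n → ℚ
  empirical c xs I = c * fromℕ (occurrences I xs)

  expect-empirical : ∀ c xs → All (T ∘ isIdealᵇ P) xs → ∀ f →
                     expect P (empirical c xs) f ≡ c * sumℚ (map f xs)
  expect-empirical c xs ideal f = begin
    sumℚ (map (λ I → c * fromℕ (occurrences I xs) * f I) (ideals P))
      ≡⟨ cong sumℚ (Listₚ.map-cong (λ I → ℚₚ.*-assoc c _ (f I)) (ideals P)) ⟩
    sumℚ (map (λ I → c * (fromℕ (occurrences I xs) * f I)) (ideals P))
      ≡⟨ sumℚ-map-*ˡ c (λ I → fromℕ (occurrences I xs) * f I) (ideals P) ⟩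
    c * sumℚ (map (λ I → fromℕ (occurrences I xs) * f I) (ideals P))
      ≡⟨ cong (c *_) (swap xs ideal) ⟩
    c * sumℚ (map f xs) ∎
    where
    open ≡-Reasoning
    swap : ∀ xs → All (T ∘ isIdealᵇ P) xs →
           sumℚ (map (λ I → fromℕ (occurrences I xs) * f I) (ideals P)) ≡ sumℚ (map f xs)
    swap []       _ = trans (cong sumℚ (Listₚ.map-cong (λ I → ℚₚ.*-zeroˡ (f I)) (ideals P)))
                            (sumℚ-map-0 (ideals P))
    swap (x ∷ xs) (x-ideal ∷ ideal) = begin
      sumℚ (map (λ I → fromℕ (occurrences I (x ∷ xs)) * f I) (ideals P))
        ≡⟨ cong sumℚ (Listₚ.map-cong split (ideals P)) ⟩
      sumℚ (map (λ I → fromℕ (same I) * f I ℚ.+ fromℕ (occurrences I xs) * f I) (ideals P))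
        ≡⟨ sumℚ-map-+ (λ I → fromℕ (same I) * f I) (λ I → fromℕ (occurrences I xs) * f I)
                      (ideals P) ⟩
      sumℚ (map (λ I → fromℕ (same I) * f I) (ideals P))
        ℚ.+ sumℚ (map (λ I → fromℕ (occurrences I xs) * f I) (ideals P))
        ≡⟨ cong₂ ℚ._+_ (weighted-occurrences f x (ideals P)) (swap xs ideal) ⟩
      fromℕ (occurrences x (ideals P)) * f x ℚ.+ sumℚ (map f xs)
        ≡⟨ cong (λ k → fromℕ k * f x ℚ.+ sumℚ (map f xs)) (occurrences-ideals x-ideal) ⟩
      1ℚ * f x ℚ.+ sumℚ (map f xs)
        ≡⟨ cong (ℚ._+ sumℚ (map f xs)) (ℚₚ.*-identityˡ (f x)) ⟩
      f x ℚ.+ sumℚ (map f xs) ∎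
      where
      same : Vec Bool n → ℕ
      same I = indicator (does (I ≟ᵛ x))
      split : ∀ I → fromℕ (occurrences I (x ∷ xs)) * f I
                  ≡ fromℕ (same I) * f I ℚ.+ fromℕ (occurrences I xs) * f I
      split I = begin
        fromℕ (indicator (does (x ≟ᵛ I)) + occurrences I xs) * f I
          ≡⟨ cong (λ b → fromℕ (indicator b + occurrences I xs) * f I) (does-≟ᵛ-sym x I) ⟩
        fromℕ (same I + occurrences I xs) * f I
          ≡⟨ cong (_* f I) (fromℕ-+ (same I) (occurrences I xs)) ⟩
        (fromℕ (same I) ℚ.+ fromℕ (occurrences I xs)) * f I
          ≡⟨ ℚₚ.*-distribʳ-+ (f I) (fromℕ (same I)) (fromℕ (occurrences I xs)) ⟩
        fromℕ (same I) * f I ℚ.+ fromℕ (occurrences I xs) * f I ∎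

-- Averages over a row-orbit

module Orbit (P : FinPoset) (L : LinearExtension P) (m : ℕ) (T₀ : Fin (FinPoset.n P) → ℕ)
             (pp₀ : IsPP P (suc m) T₀) (k-1 : ℕ)
             (periodic : ∀ p → iter (row P L (suc m)) (suc k-1) (embed P T₀) p ≡ embed P T₀ p) where
  open FinPoset P
  open Order P
  open Toggles P L (suc m)
  open Scaling P L m
  open Sublevels P L (suc m)
  open Empirical P

  ℓ k : ℕ
  ℓ = suc m
  k = suc k-1

  S : ℕ → Fin n → ℕ
  S j = iter rowℕ j T₀

  S-PP : ∀ j → PP (S j)
  S-PP j = iter-rowℕ-PP j pp₀

  S-periodic : ∀ p → S k p ≡ S 0 p
  S-periodic p = fromℕ-injective (trans (sym (iter-row-embed k pp₀ p)) (periodic p))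

  preimage≡sublevel : ∀ j i → preimageLE P (iter (row P L ℓ) j (embed P T₀)) i ≡ sublevel (S j) i
  preimage≡sublevel j i = Vecₚ.tabulate-cong λ q →
    trans (cong (ℚ._≤ᵇ fromℕ i) (iter-row-embed j pp₀ q)) (fromℕ-≤ᵇ (S j q) i)

  orbitIdeals : List (Vec Bool n)
  orbitIdeals = concat (map (λ j → map (sublevel (S j)) (upTo ℓ)) (upTo k))

  Σ-orbit : (ℕ → ℕ) → ℕ
  Σ-orbit g = sum (map g (upTo k))

  Σ-orbit-+ : ∀ f g → Σ-orbit (λ j → f j + g j) ≡ Σ-orbit f + Σ-orbit g
  Σ-orbit-+ f g = sum-map-+ f g (upTo k)

  Σ-orbit-cong : ∀ {f g} → (∀ j → f j ≡ g j) → Σ-orbit f ≡ Σ-orbit g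
  Σ-orbit-cong f≗g = cong sum (Listₚ.map-cong f≗g (upTo k))

  sum-orbitIdeals : ∀ (g : Vec Bool n → ℕ) →
    sum (map g orbitIdeals) ≡ Σ-orbit (λ j → sum (map (g ∘ sublevel (S j)) (upTo ℓ)))
  sum-orbitIdeals g = trans
    (sum-map-concat g (map (λ j → map (sublevel (S j)) (upTo ℓ)) (upTo k)))
    (cong sum (trans (sym (Listₚ.map-∘ (upTo k)))
                     (Listₚ.map-cong (λ j → cong sum (sym (Listₚ.map-∘ (upTo ℓ)))) (upTo k))))

  orbitIdeals-ideal : All (T ∘ isIdealᵇ P) orbitIdeals
  orbitIdeals-ideal = concat⁺ (map⁺ (All.universal (λ j → map⁺ (All.universal (λ i →
    from (T-isIdealᵇ⇔ {sublevel (S j) i}) (sublevel-ideal (S-PP j) i)) (upTo ℓ))) (upTo k)))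

  module _ (p : Fin n) where
    added removed value upper lower : ℕ → ℕ
    added j   = sum (map (λ i → indicator (addable (sublevel (S j) i) p)) (upTo ℓ))
    removed j = sum (map (λ i → indicator (removable (sublevel (S j) i) p)) (upTo ℓ))
    value j   = S j p
    upper j   = upperℕ (S j) p
    lower j   = lowerℕ (S j) p

    -- Periodicity lets the index shifts cancel.
    values-twice : Σ-orbit value + Σ-orbit value ≡ Σ-orbit upper + Σ-orbit lower
    values-twice = begin
      Σ-orbit value + Σ-orbit value
        ≡⟨ cong (_+ Σ-orbit value) (sum-shift value k (S-periodic p)) ⟨
      Σ-orbit (value ∘ suc) + Σ-orbit value
        ≡⟨ Σ-orbit-+ (value ∘ suc) value ⟨
      Σ-orbit (λ j → value (suc j) + value j)
        ≡⟨ Σ-orbit-cong (λ j → rowℕ-recurrence (S-PP j) p) ⟩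
      Σ-orbit (λ j → upper (suc j) + lower j)
        ≡⟨ Σ-orbit-+ (upper ∘ suc) lower ⟩
      Σ-orbit (upper ∘ suc) + Σ-orbit lower
        ≡⟨ cong (_+ Σ-orbit lower) (sum-shift upper k upper-periodic) ⟩
      Σ-orbit upper + Σ-orbit lower ∎
      where
      open ≡-Reasoning
      upper-periodic : upper k ≡ upper 0
      upper-periodic = upperℕ-cong p (λ c _ → S-periodic c)

    added≡removed : Σ-orbit added ≡ Σ-orbit removed
    added≡removed = ℕₚ.+-cancelʳ-≡ _ _ _ (begin
      Σ-orbit added + (Σ-orbit lower + Σ-orbit value)  ≡⟨ ℕₚ.+-assoc (Σ-orbit added) _ _ ⟨
      Σ-orbit added + Σ-orbit lower + Σ-orbit value    ≡⟨ cong (_+ Σ-orbit value) added+lower ⟩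
      Σ-orbit value + Σ-orbit value                    ≡⟨ values-twice ⟩
      Σ-orbit upper + Σ-orbit lower                    ≡⟨ cong (_+ Σ-orbit lower) removed+value ⟨
      Σ-orbit removed + Σ-orbit value + Σ-orbit lower  ≡⟨ ℕₚ.+-assoc (Σ-orbit removed) _ _ ⟩
      Σ-orbit removed + (Σ-orbit value + Σ-orbit lower) ≡⟨ cong (Σ-orbit removed +_) (ℕₚ.+-comm (Σ-orbit value) (Σ-orbit lower)) ⟩
      Σ-orbit removed + (Σ-orbit lower + Σ-orbit value) ∎)
      where
      open ≡-Reasoning
      added+lower : Σ-orbit added + Σ-orbit lower ≡ Σ-orbit value
      added+lower = trans (sym (Σ-orbit-+ added lower)) (Σ-orbit-cong λ j → addable-count (S-PP j))
      removed+value : Σ-orbit removed + Σ-orbit value ≡ Σ-orbit upper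
      removed+value = trans (sym (Σ-orbit-+ removed value)) (Σ-orbit-cong λ j → removable-count (S-PP j))

    toggleability-sum : sumℚ (map (𝒯 P p) orbitIdeals) ≡ 0ℚ
    toggleability-sum = begin
      sumℚ (map (𝒯 P p) orbitIdeals)
        ≡⟨ cong sumℚ (Listₚ.map-cong (𝒯≡addable-removable P p) orbitIdeals) ⟩
      sumℚ (map (λ I → fromℕ (canAdd I) ℚ.- fromℕ (canRemove I)) orbitIdeals)
        ≡⟨ sumℚ-map-- (fromℕ ∘ canAdd) (fromℕ ∘ canRemove) orbitIdeals ⟩
      sumℚ (map (fromℕ ∘ canAdd) orbitIdeals) ℚ.- sumℚ (map (fromℕ ∘ canRemove) orbitIdeals)
        ≡⟨ cong₂ ℚ._-_ (fromℕ-sum canAdd orbitIdeals) (fromℕ-sum canRemove orbitIdeals) ⟨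
      fromℕ (sum (map canAdd orbitIdeals)) ℚ.- fromℕ (sum (map canRemove orbitIdeals))
        ≡⟨ cong₂ (λ a r → fromℕ a ℚ.- fromℕ r) (sum-orbitIdeals canAdd) (sum-orbitIdeals canRemove) ⟩
      fromℕ (Σ-orbit added) ℚ.- fromℕ (Σ-orbit removed)
        ≡⟨ cong (λ a → fromℕ a ℚ.- fromℕ (Σ-orbit removed)) added≡removed ⟩
      fromℕ (Σ-orbit removed) ℚ.- fromℕ (Σ-orbit removed)
        ≡⟨ ℚₚ.+-inverseʳ (fromℕ (Σ-orbit removed)) ⟩
      0ℚ ∎
      where
      open ≡-Reasoning
      canAdd canRemove : Vec Bool n → ℕ
      canAdd I    = indicator (addable I p)
      canRemove I = indicator (removable I p)

  1/k : ℚ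
  1/k = ℤ.+ 1 ℚ./ k

  weight : ℚ
  weight = 1/k * 1/ℓ

  μ : Vec Bool n → ℚ
  μ = empirical weight orbitIdeals

  expect-μ : ∀ f → expect P μ f ≡ weight * sumℚ (map f orbitIdeals)
  expect-μ = expect-empirical weight orbitIdeals orbitIdeals-ideal

  weight*kℓ : weight * fromℕ (k ℕ.* ℓ) ≡ 1ℚ
  weight*kℓ = begin
    1/k * 1/ℓ * fromℕ (k ℕ.* ℓ)             ≡⟨ cong (1/k * 1/ℓ *_) (fromℕ-* k ℓ) ⟩
    1/k * 1/ℓ * (fromℕ k * fromℕ ℓ)         ≡⟨ regroup 1/k 1/ℓ (fromℕ k) (fromℕ ℓ) ⟩
    (fromℕ k * 1/k) * (fromℕ ℓ * 1/ℓ)       ≡⟨ cong₂ _*_ (fromℕ-*-inverse k-1) (fromℕ-*-inverse m) ⟩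
    1ℚ                                      ∎
    where
    open ≡-Reasoning
    open +-*-Solver
    regroup : ∀ a b x y → a * b * (x * y) ≡ (x * a) * (y * b)
    regroup = solve 4 (λ a b x y → a :* b :* (x :* y) := (x :* a) :* (y :* b)) refl

  μ-distribution : IsDistribution P μ
  μ-distribution = nonNegative , total
    where
    instance
      1/k-nonNeg : ℚ.NonNegative 1/k
      1/k-nonNeg = ℚₚ.normalize-nonNeg 1 k
      1/ℓ-nonNeg : ℚ.NonNegative 1/ℓ
      1/ℓ-nonNeg = ℚₚ.normalize-nonNeg 1 ℓ
      weight-nonNeg : ℚ.NonNegative weight
      weight-nonNeg = ℚₚ.nonNeg*nonNeg⇒nonNeg 1/k 1/ℓ
    nonNegative : ∀ I → I ∈ ideals P → 0ℚ ℚ.≤ μ I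
    nonNegative I _ = ℚₚ.nonNegative⁻¹ (μ I)
      {{ℚₚ.nonNeg*nonNeg⇒nonNeg weight (fromℕ (occurrences I orbitIdeals))
          {{ℚₚ.normalize-nonNeg (occurrences I orbitIdeals) 1}}}}
    total : sumℚ (map μ (ideals P)) ≡ 1ℚ
    total = begin
      sumℚ (map μ (ideals P))
        ≡⟨ cong sumℚ (Listₚ.map-cong (λ I → ℚₚ.*-identityʳ (μ I)) (ideals P)) ⟨
      expect P μ (λ _ → 1ℚ)
        ≡⟨ expect-μ (λ _ → 1ℚ) ⟩
      weight * sumℚ (map (λ _ → 1ℚ) orbitIdeals)
        ≡⟨ cong (weight *_) (fromℕ-sum (λ _ → 1) orbitIdeals) ⟨
      weight * fromℕ (sum (map (λ _ → 1) orbitIdeals))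
        ≡⟨ cong (λ x → weight * fromℕ x) size ⟩
      weight * fromℕ (k ℕ.* ℓ)
        ≡⟨ weight*kℓ ⟩
      1ℚ ∎
      where
      open ≡-Reasoning
      count-ℓ : sum (map (λ _ → 1) (upTo ℓ)) ≡ ℓ
      count-ℓ = trans (sum-map-const 1 (upTo ℓ)) (trans (ℕₚ.*-identityʳ _) (Listₚ.length-upTo ℓ))
      size : sum (map (λ _ → 1) orbitIdeals) ≡ k ℕ.* ℓ
      size = begin
        sum (map (λ _ → 1) orbitIdeals)                   ≡⟨ sum-orbitIdeals (λ _ → 1) ⟩
        Σ-orbit (λ _ → sum (map (λ _ → 1) (upTo ℓ)))      ≡⟨ sum-map-const _ (upTo k) ⟩
        length (upTo k) ℕ.* sum (map (λ _ → 1) (upTo ℓ))  ≡⟨ cong₂ ℕ._*_ (Listₚ.length-upTo k) count-ℓ ⟩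
        k ℕ.* ℓ                                           ∎

  μ-toggleSymmetric : ToggleSymmetric P μ
  μ-toggleSymmetric p =
    trans (expect-μ (𝒯 P p)) (trans (cong (weight *_) (toggleability-sum p)) (ℚₚ.*-zeroʳ weight))

  ddegAt : ℕ → ℕ
  ddegAt j = ddegPP P ℓ (iter (row P L ℓ) j (embed P T₀))

  orbit-ddeg : sum (map (ddeg P) orbitIdeals) ≡ Σ-orbit ddegAt
  orbit-ddeg = trans (sum-orbitIdeals (ddeg P)) (Σ-orbit-cong λ j →
    cong sum (Listₚ.map-cong (λ i → cong (ddeg P) (sym (preimage≡sublevel j i))) (upTo ℓ)))

  edgeDensity≡ : tCDE P → edgeDensity P ≡ weight * fromℕ (Σ-orbit ddegAt)
  edgeDensity≡ tcde = begin
    edgeDensity P                                    ≡⟨ tcde μ μ-distribution μ-toggleSymmetric ⟨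
    expect P μ (ddegℚ P)                             ≡⟨ expect-μ (ddegℚ P) ⟩
    weight * sumℚ (map (ddegℚ P) orbitIdeals)        ≡⟨ cong (weight *_) (fromℕ-sum (ddeg P) orbitIdeals) ⟨
    weight * fromℕ (sum (map (ddeg P) orbitIdeals))  ≡⟨ cong (λ x → weight * fromℕ x) orbit-ddeg ⟩
    weight * fromℕ (Σ-orbit ddegAt)                  ∎
    where open ≡-Reasoning

  *1/k≡ℓ*weight* : ∀ x → x * 1/k ≡ fromℕ ℓ * (weight * x)
  *1/k≡ℓ*weight* x = begin
    x * 1/k                    ≡⟨ ℚₚ.*-identityˡ (x * 1/k) ⟨
    1ℚ * (x * 1/k)             ≡⟨ cong (_* (x * 1/k)) (fromℕ-*-inverse m) ⟨
    fromℕ ℓ * 1/ℓ * (x * 1/k)  ≡⟨ regroup (fromℕ ℓ) 1/ℓ x 1/k ⟩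
    fromℕ ℓ * (1/k * 1/ℓ * x)  ∎
    where
    open ≡-Reasoning
    open +-*-Solver
    regroup : ∀ a b x c → a * b * (x * c) ≡ a * (c * b * x)
    regroup = solve 4 (λ a b x c → a :* b :* (x :* c) := a :* (c :* b :* x)) refl

  orbitAverage≡ : tCDE P → orbitAverage P L ℓ T₀ k ≡ fromℕ ℓ * edgeDensity P
  orbitAverage≡ tcde = begin
    sumℚ (map (fromℕ ∘ ddegAt) (upTo k)) * 1/k  ≡⟨ cong (_* 1/k) (fromℕ-sum ddegAt (upTo k)) ⟨
    fromℕ (Σ-orbit ddegAt) * 1/k                ≡⟨ *1/k≡ℓ*weight* (fromℕ (Σ-orbit ddegAt)) ⟩
    fromℕ ℓ * (weight * fromℕ (Σ-orbit ddegAt)) ≡⟨ cong (fromℕ ℓ *_) (edgeDensity≡ tcde) ⟨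
    fromℕ ℓ * edgeDensity P                     ∎
    where open ≡-Reasoning

corollary4p34 : (P : FinPoset) → tCDE P →
    (ℓ : ℕ) → 1 ≤ ℓ → (L : LinearExtension P) →
    Mesic P L ℓ (fromℕ ℓ * edgeDensity P)
corollary4p34 P tcde (suc m) (s≤s z≤n) L T pp (suc k-1) (s≤s z≤n , periodic , _) =
  Orbit.orbitAverage≡ P L m T pp k-1 periodic tcde
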